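{- Each of the following logics is sound with respect to its frame class: $\mathsf{FOFS.D}$ with respect to $\mathsf{FOFS}$ frames in which $R$ is serial; $\mathsf{FOFS4}$ with respect to those in which $R$ is transitive; $\mathsf{FOFS.D4}$ with respect to those in which $R$ is serial and transitive; $\mathsf{FOFS.T}$ with respect to those in which $R$ is reflexive; $\mathsf{FOFS.S4}$ with respect to those in which $R$ is a quasi-order (reflexive and transitive). That is, every theorem of the logic holds at every world of every $\mathsf{FOFS}$ model whose frame lies in the corresponding class.
   Context: Syntax. A signature $\sigma$ has a countably infinite set of constants, a countable set of predicate symbols with positive arities. Formulas over a countably infinite variable set: $P(\bar t)$, $s\doteq t$, $\land,\lor,\to,\Box,\Diamond,\forall x,\exists x,\bot$; $\neg\phi:=\phi\to\bot$, $\top:=\neg\bot$. Sentences have no free variables; for a one-place formula $\phi$, $\phi(t)$ substitutes the term $t$ for its free variable. $\mathsf{FOFS}$ is the Hilbert system on sentences with axioms: substitution instances of intuitionistic propositional tautologies; $\Box(\phi\land\psi)\leftrightarrow(\Box\phi\land\Box\psi)$; $\Box\top$; $\Diamond(\phi\lor\psi)\leftrightarrow(\Diamond\phi\lor\Diamond\psi)$; $\neg\Diamond\bot$; $(\Diamond\phi\to\Box\psi)\to\Box(\phi\to\psi)$; $\Diamond(\phi\to\psi)\to(\Box\phi\to\Diamond\psi)$; $\forall x\phi(x)\to\phi(c)$; $\phi(c)\to\exists x\phi(x)$; $\forall x(\phi(x)\to\psi)\to(\exists x\phi(x)\to\psi)$; $\forall x(\phi\to\psi(x))\to(\phi\to\forall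 x\psi(x))$; $c\doteq c$; $c_1\doteq c_2\to(\phi(c_1)\to\phi(c_2))$ for modal-free $\phi$; rules modus ponens, generalization on a constant (from $\phi(c)$ infer $\forall x\phi(x)$, $x$ substitutable for $c$), and from $\phi\to\psi$ infer $\Box\phi\to\Box\psi$ and $\Diamond\phi\to\Diamond\psi$. The extensions add axiom schemes (for all sentences $\phi$): $\mathsf{FOFS.D}$ adds $\Box\phi\to\Diamond\phi$; $\mathsf{FOFS4}$ adds $\Box\phi\to\Box\Box\phi$ and $\Diamond\Diamond\phi\to\Diamond\phi$; $\mathsf{FOFS.D4}$ adds all three; $\mathsf{FOFS.T}$ adds $\Box\phi\to\phi$ and $\phi\to\Diamond\phi$; $\mathsf{FOFS.S4}$ adds $\Box\phi\to\phi$, $\phi\to\Diamond\phi$, $\Box\phi\to\Box\Box\phi$, $\Diamond\Diamond\phi\to\Diamond\phi$. Semantics. An $\mathsf{FOFS}$ frame is $(W,\preccurlyeq,R,D,\sim)$: $\preccurlyeq$ a partial order, $R$ a relation with (FC1) $wRv$, $v\preccurlyeq v'$ imply some $w'\succcurlyeq w$ with $w'Rv'$, and (FC2) $w\preccurlyeq w'$, $wRv$ imply some $v'\succcurlyeq v$ with $w'Rv'$; sets $D(w)$ with $D(w)\subseteq D(w')$ when $w\preccurlyeq w'$ or $wRw'$; equivalence relations $\sim_w$ on $D(w)$ preserved along $\preccurlyeq$. A model adds $I(c)\in\bigcap_wD(w)$ and $I_w(P)\subseteq D(w)^n$ monotone along $\preccurlyeq$ and closed under $\sim_w$. Truth under $g:V\to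 D(w)$: atoms via $I_w$ and $\sim_w$; $\land,\lor$ pointwise; $\phi\to\psi$ holds at $w$ iff at every $w'\succcurlyeq w$, $\phi$ fails or $\psi$ holds; $\Box\phi$ iff $\phi$ holds at all $v'$ with $w\preccurlyeq w'Rv'$ for some $w'$; $\Diamond\phi$ iff $\phi$ holds at some $R$-successor; $\forall x\phi$ iff for all $w'\succcurlyeq w$ and $a\in D(w')$, $\phi$ holds at $w'$ under $g[x:=a]$; $\exists x\phi$ iff some $a\in D(w)$ witnesses; $\bot$ never. -}

module Defs where

open import Data.Nat using (ℕ; _≡ᵇ_; _≤_)
open import Data.Bool using (if_then_else_)
open import Data.Vec using (Vec; map)
open import Data.Vec.Relation.Unary.Any using (Any)
open import Data.Vec.Relation.Unary.All using (All)
open import Data.Vec.Relation.Binary.Pointwise.Inductive using (Pointwise)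
open import Data.Product using (Σ; _×_)
open import Data.Sum using (_⊎_)
open import Data.Empty using (⊥)
open import Data.Unit using (⊤)
open import Relation.Binary.PropositionalEquality using (_≡_; _≢_)
open import Function.Definitions using (Injective)

-- Intuitionistic propositional logic (for "substitution instances of
-- intuitionistic propositional tautologies").

data PForm : Set where
  pvar        : ℕ → PForm
  p⊥          : PForm
  _p∧_ _p∨_ _p⇒_ : PForm → PForm → PForm

infixr 5 _p⇒_

data IPC : PForm → Set where
  ax-K   : ∀ A B → IPC (A p⇒ (B p⇒ A))
  ax-S   : ∀ A B C → IPC ((A p⇒ (B p⇒ C)) p⇒ ((A p⇒ B) p⇒ (A p⇒ C)))
  ax-∧I  : ∀ A B → IPC (A p⇒ (B p⇒ (A p∧ B)))
  ax-∧E₁ : ∀ A B → IPC ((A p∧ B) p⇒ A)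
  ax-∧E₂ : ∀ A B → IPC ((A p∧ B) p⇒ B)
  ax-∨I₁ : ∀ A B → IPC (A p⇒ (A p∨ B))
  ax-∨I₂ : ∀ A B → IPC (B p⇒ (A p∨ B))
  ax-∨E  : ∀ A B C → IPC ((A p⇒ C) p⇒ ((B p⇒ C) p⇒ ((A p∨ B) p⇒ C)))
  ax-EFQ : ∀ A → IPC (p⊥ p⇒ A)
  mp     : ∀ {A B} → IPC (A p⇒ B) → IPC A → IPC B

-- Signatures: constants are ℕ (countably infinite); predicate symbols
-- form a countable set (injection into ℕ) with positive arities.

record Signature : Set₁ where
  field
    Pred      : Set
    encode    : Pred → ℕ
    encode-inj : Injective _≡_ _≡_ encode
    arity     : Pred → ℕ
    arity-pos : ∀ P → 1 ≤ arity P

Var Const : Set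
Var   = ℕ
Const = ℕ

data Logic : Set where
  FOFS FOFS-D FOFS4 FOFS-D4 FOFS-T FOFS-S4 : Logic

module _ (S : Signature) where
  open Signature S

  data Term : Set where
    var : Var → Term
    con : Const → Term

  data Form : Set where
    atom : (P : Pred) → Vec Term (arity P) → Form
    _≐_  : Term → Term → Form
    _∧_ _∨_ _⇒_ : Form → Form → Form
    □ ◇  : Form → Form
    all ex : Var → Form → Form
    ⊥'   : Form

  ¬' : Form → Form
  ¬' φ = φ ⇒ ⊥'

  ⊤' : Form
  ⊤' = ¬' ⊥'

  _⇔_ : Form → Form → Form
  φ ⇔ ψ = (φ ⇒ ψ) ∧ (ψ ⇒ φ)

  FreeT : Var → Term → Set
  FreeT x (var y) = x ≡ y
  FreeT x (con c) = ⊥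

  Free : Var → Form → Set
  Free x (atom P ts) = Any (FreeT x) ts
  Free x (s ≐ t)     = FreeT x s ⊎ FreeT x t
  Free x (φ ∧ ψ)     = Free x φ ⊎ Free x ψ
  Free x (φ ∨ ψ)     = Free x φ ⊎ Free x ψ
  Free x (φ ⇒ ψ)     = Free x φ ⊎ Free x ψ
  Free x (□ φ)       = Free x φ
  Free x (◇ φ)       = Free x φ
  Free x (all y φ)   = x ≢ y × Free x φ
  Free x (ex y φ)    = x ≢ y × Free x φ
  Free x ⊥'          = ⊥

  Sentence : Form → Set
  Sentence φ = ∀ y → Free y φ → ⊥

  OnePlace : Var → Form → Set
  OnePlace x φ = ∀ y → Free y φ → y ≡ x

  ConstT : Const → Term → Set
  ConstT c (var y) = ⊥
  ConstT c (con d) = c ≡ d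

  ConstIn : Const → Form → Set
  ConstIn c (atom P ts) = Any (ConstT c) ts
  ConstIn c (s ≐ t)     = ConstT c s ⊎ ConstT c t
  ConstIn c (φ ∧ ψ)     = ConstIn c φ ⊎ ConstIn c ψ
  ConstIn c (φ ∨ ψ)     = ConstIn c φ ⊎ ConstIn c ψ
  ConstIn c (φ ⇒ ψ)     = ConstIn c φ ⊎ ConstIn c ψ
  ConstIn c (□ φ)       = ConstIn c φ
  ConstIn c (◇ φ)       = ConstIn c φ
  ConstIn c (all y φ)   = ConstIn c φ
  ConstIn c (ex y φ)    = ConstIn c φ
  ConstIn c ⊥'          = ⊥

  ModalFree : Form → Set
  ModalFree (atom P ts) = ⊤
  ModalFree (s ≐ t)     = ⊤
  ModalFree (φ ∧ ψ)     = ModalFree φ × ModalFree ψ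
  ModalFree (φ ∨ ψ)     = ModalFree φ × ModalFree ψ
  ModalFree (φ ⇒ ψ)     = ModalFree φ × ModalFree ψ
  ModalFree (□ φ)       = ⊥
  ModalFree (◇ φ)       = ⊥
  ModalFree (all y φ)   = ModalFree φ
  ModalFree (ex y φ)    = ModalFree φ
  ModalFree ⊥'          = ⊤

  -- substitution of the term t for the free occurrences of x
  -- (only used with t a constant, so no capture can occur)
  substT : Var → Term → Term → Term
  substT x t (var y) = if x ≡ᵇ y then t else var y
  substT x t (con c) = con c

  subst : Var → Term → Form → Form
  subst x t (atom P ts) = atom P (map (substT x t) ts)
  subst x t (s ≐ u)     = substT x t s ≐ substT x t u
  subst x t (φ ∧ ψ)     = subst x t φ ∧ subst x t ψ
  subst x t (φ ∨ ψ)     = subst x t φ ∨ subst x t ψ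
  subst x t (φ ⇒ ψ)     = subst x t φ ⇒ subst x t ψ
  subst x t (□ φ)       = □ (subst x t φ)
  subst x t (◇ φ)       = ◇ (subst x t φ)
  subst x t (all y φ)   = if x ≡ᵇ y then all y φ else all y (subst x t φ)
  subst x t (ex y φ)    = if x ≡ᵇ y then ex y φ else ex y (subst x t φ)
  subst x t ⊥'          = ⊥'

  inst : (ℕ → Form) → PForm → Form
  inst σ (pvar p)  = σ p
  inst σ p⊥        = ⊥'
  inst σ (A p∧ B)  = inst σ A ∧ inst σ B
  inst σ (A p∨ B)  = inst σ A ∨ inst σ B
  inst σ (A p⇒ B)  = inst σ A ⇒ inst σ B

  data ExtraAx : Logic → Form → Set where
    D-D   : ∀ φ → ExtraAx FOFS-D  (□ φ ⇒ ◇ φ)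
    4-□   : ∀ φ → ExtraAx FOFS4   (□ φ ⇒ □ (□ φ))
    4-◇   : ∀ φ → ExtraAx FOFS4   (◇ (◇ φ) ⇒ ◇ φ)
    D4-D  : ∀ φ → ExtraAx FOFS-D4 (□ φ ⇒ ◇ φ)
    D4-□  : ∀ φ → ExtraAx FOFS-D4 (□ φ ⇒ □ (□ φ))
    D4-◇  : ∀ φ → ExtraAx FOFS-D4 (◇ (◇ φ) ⇒ ◇ φ)
    T-□   : ∀ φ → ExtraAx FOFS-T  (□ φ ⇒ φ)
    T-◇   : ∀ φ → ExtraAx FOFS-T  (φ ⇒ ◇ φ)
    S4-T□ : ∀ φ → ExtraAx FOFS-S4 (□ φ ⇒ φ)
    S4-T◇ : ∀ φ → ExtraAx FOFS-S4 (φ ⇒ ◇ φ)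
    S4-4□ : ∀ φ → ExtraAx FOFS-S4 (□ φ ⇒ □ (□ φ))
    S4-4◇ : ∀ φ → ExtraAx FOFS-S4 (◇ (◇ φ) ⇒ ◇ φ)

  data Prf (L : Logic) : Form → Set where
    taut    : ∀ (σ : ℕ → Form) → (∀ p → Sentence (σ p)) → ∀ A → IPC A →
              Prf L (inst σ A)
    □∧      : ∀ φ ψ → Sentence φ → Sentence ψ →
              Prf L (□ (φ ∧ ψ) ⇔ (□ φ ∧ □ ψ))
    □⊤      : Prf L (□ ⊤')
    ◇∨      : ∀ φ ψ → Sentence φ → Sentence ψ →
              Prf L (◇ (φ ∨ ψ) ⇔ (◇ φ ∨ ◇ ψ))
    ¬◇⊥     : Prf L (¬' (◇ ⊥'))
    ax-◇□   : ∀ φ ψ → Sentence φ → Sentence ψ →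
              Prf L ((◇ φ ⇒ □ ψ) ⇒ □ (φ ⇒ ψ))
    ax-◇⇒   : ∀ φ ψ → Sentence φ → Sentence ψ →
              Prf L (◇ (φ ⇒ ψ) ⇒ (□ φ ⇒ ◇ ψ))
    ∀-inst  : ∀ x φ c → OnePlace x φ →
              Prf L (all x φ ⇒ subst x (con c) φ)
    ∃-intro : ∀ x φ c → OnePlace x φ →
              Prf L (subst x (con c) φ ⇒ ex x φ)
    ∃-elim  : ∀ x φ ψ → OnePlace x φ → Sentence ψ →
              Prf L (all x (φ ⇒ ψ) ⇒ (ex x φ ⇒ ψ))
    ∀-dist  : ∀ x φ ψ → Sentence φ → OnePlace x ψ →
              Prf L (all x (φ ⇒ ψ) ⇒ (φ ⇒ all x ψ))
    refl≐   : ∀ c → Prf L (con c ≐ con c)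
    repl≐   : ∀ x φ c₁ c₂ → OnePlace x φ → ModalFree φ →
              Prf L ((con c₁ ≐ con c₂) ⇒
                     (subst x (con c₁) φ ⇒ subst x (con c₂) φ))
    extra   : ∀ φ → Sentence φ → ExtraAx L φ → Prf L φ
    mp      : ∀ {φ ψ} → Prf L (φ ⇒ ψ) → Prf L φ → Prf L ψ
    gen     : ∀ x φ c → OnePlace x φ → (ConstIn c φ → ⊥) →
              Prf L (subst x (con c) φ) → Prf L (all x φ)
    mono□   : ∀ {φ ψ} → Sentence φ → Sentence ψ →
              Prf L (φ ⇒ ψ) → Prf L (□ φ ⇒ □ ψ)
    mono◇   : ∀ {φ ψ} → Sentence φ → Sentence ψ →
              Prf L (φ ⇒ ψ) → Prf L (◇ φ ⇒ ◇ ψ)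

record Frame : Set₁ where
  field
    W      : Set
    _≼_    : W → W → Set
    ≼-refl : ∀ w → w ≼ w
    ≼-trans : ∀ {u v w} → u ≼ v → v ≼ w → u ≼ w
    ≼-antisym : ∀ {u v} → u ≼ v → v ≼ u → u ≡ v
    R      : W → W → Set
    FC1    : ∀ {w v v'} → R w v → v ≼ v' → Σ W λ w' → w ≼ w' × R w' v'
    FC2    : ∀ {w w' v} → w ≼ w' → R w v → Σ W λ v' → v ≼ v' × R w' v'
    -- domains: D w is a subset of a global carrier Dom
    Dom    : Set
    D      : W → Dom → Set
    D-≼    : ∀ {w w' a} → w ≼ w' → D w a → D w' a
    D-R    : ∀ {w w' a} → R w w' → D w a → D w' a
    Sim    : W → Dom → Dom → Set
    Sim-dom   : ∀ {w a b} → Sim w a b → D w a × D w b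
    Sim-refl  : ∀ {w a} → D w a → Sim w a a
    Sim-sym   : ∀ {w a b} → Sim w a b → Sim w b a
    Sim-trans : ∀ {w a b c} → Sim w a b → Sim w b c → Sim w a c
    Sim-≼     : ∀ {w w' a b} → w ≼ w' → Sim w a b → Sim w' a b

Serial Reflexive Transitive : Frame → Set
Serial F      = ∀ w → Σ W λ v → R w v  where open Frame F
Reflexive F   = ∀ w → R w w            where open Frame F
Transitive F  = ∀ {u v w} → R u v → R v w → R u w  where open Frame F

record Model (S : Signature) : Set₁ where
  open Signature S
  field
    frame : Frame
  open Frame frame public
  field
    I       : Const → Dom
    I-dom   : ∀ c w → D w (I c)
    Int     : W → (P : Pred) → Vec Dom (arity P) → Set
    Int-dom : ∀ {w P as} → Int w P as → All (D w) as
    Int-≼   : ∀ {w w' P as} → w ≼ w' → Int w P as → Int w' P as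
    Int-Sim : ∀ {w P as bs} → Pointwise (Sim w) as bs →
              Int w P as → Int w P bs

module _ {S : Signature} (M : Model S) where
  open Model M

  _[_≔_] : (Var → Dom) → Var → Dom → (Var → Dom)
  (g [ x ≔ a ]) y = if y ≡ᵇ x then a else g y

  evalT : (Var → Dom) → Term S → Dom
  evalT g (var x) = g x
  evalT g (con c) = I c

  Sat : W → (Var → Dom) → Form S → Set
  Sat w g (atom P ts) = Int w P (map (evalT g) ts)
  Sat w g (s ≐ t)     = Sim w (evalT g s) (evalT g t)
  Sat w g (φ ∧ ψ)     = Sat w g φ × Sat w g ψ
  Sat w g (φ ∨ ψ)     = Sat w g φ ⊎ Sat w g ψ
  Sat w g (φ ⇒ ψ)     = ∀ w' → w ≼ w' → Sat w' g φ → Sat w' g ψ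
  Sat w g (□ φ)       = ∀ w' v' → w ≼ w' → R w' v' → Sat v' g φ
  Sat w g (◇ φ)       = Σ W λ v → R w v × Sat v g φ
  Sat w g (all x φ)   = ∀ w' → w ≼ w' → ∀ a → D w' a → Sat w' (g [ x ≔ a ]) φ
  Sat w g (ex x φ)    = Σ Dom λ a → D w a × Sat w (g [ x ≔ a ]) φ
  Sat w g ⊥'          = ⊥

SoundFor : (S : Signature) → Logic → (Frame → Set) → Set₁
SoundFor S L C =
  ∀ φ → Prf S L φ →
  (M : Model S) → C (Model.frame M) →
  ∀ w (g : Var → Model.Dom M) → (∀ x → Model.D M w (g x)) →
  Sat M w g φ

-- Truth is upward persistent along ≼, which validates the intuitionistic
-- tautologies; the two axioms linking □ and ◇ are exactly the frame
-- conditions FC1 and FC2; replacement of equals is the ∼-congruence of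
-- modal-free truth; and D, 4, T hold because R is serial, transitive or
-- reflexive.  For generalization on a constant c, given a world w' and an
-- object a ∈ D(w'), reinterpret c as a, adding a to every domain so that the
-- denotation of c is still a global object.  Since c does not occur in φ(x),
-- truth of φ(c) in the new model at w' is truth of φ at a in the old one, and
-- as the worlds and R are untouched the new frame lies in the same class.

module Submission where

open import Defs
open import Data.Bool using (true; false; if_then_else_)
open import Data.Empty using (⊥-elim)
open import Data.Nat using (_≡ᵇ_; _≟_)
open import Data.Product using (Σ; _×_; _,_; proj₁; proj₂)
open import Data.Product.Function.NonDependent.Propositional using (_×-⇔_)
open import Data.Sum using (_⊎_; inj₁; inj₂; map₁)
open import Data.Sum.Function.Propositional using (_⊎-⇔_)
open import Data.Vec using (Vec; []; _∷_; map)
open import Data.Vec.Properties using (map-∘; map-cong)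
open import Data.Vec.Relation.Unary.Any using (Any; here; there)
open import Data.Vec.Relation.Unary.All using (All; []; _∷_)
import Data.Vec.Relation.Unary.All as All
open import Data.Vec.Relation.Binary.Pointwise.Inductive as Pointwise
  using (Pointwise; []; _∷_; Pointwise-≡⇒≡)
open import Function using (id; _∘_)
open import Function.Bundles using (mk⇔; module Equivalence) renaming (_⇔_ to _⟺_)
open import Function.Construct.Identity using (⇔-id)
open import Function.Properties.Equivalence using () renaming (trans to ⟺-trans)
open import Function.Related.TypeIsomorphisms using (→-cong-⇔)
open import Relation.Nullary using (¬_)
open import Relation.Nullary.Decidable using (proof)
open import Relation.Nullary.Reflects using (Reflects; ofʸ; ofⁿ)
open import Relation.Binary.PropositionalEquality
  using (_≡_; _≢_; refl; sym; trans; cong; cong₂)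
  renaming (subst to ≡-subst; subst₂ to ≡-subst₂)

open Equivalence using (to; from)

≡ᵇ-reflects : ∀ m n → Reflects (m ≡ n) (m ≡ᵇ n)
≡ᵇ-reflects m n = proof (m ≟ n)

≡⇒⟺ : {A B : Set} → A ≡ B → A ⟺ B
≡⇒⟺ refl = ⇔-id _

Π-cong-⟺ : {A : Set} {B C : A → Set} → (∀ x → B x ⟺ C x) → ((x : A) → B x) ⟺ ((x : A) → C x)
Π-cong-⟺ B⟺C = mk⇔ (λ f x → to (B⟺C x) (f x)) (λ f x → from (B⟺C x) (f x))

Π₂-cong-⟺ : {A : Set} {B : A → Set} {C D : (x : A) → B x → Set} →
            (∀ x y → C x y ⟺ D x y) → ((x : A) (y : B x) → C x y) ⟺ ((x : A) (y : B x) → D x y)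
Π₂-cong-⟺ C⟺D = Π-cong-⟺ λ x → Π-cong-⟺ (C⟺D x)

Σ-cong-⟺ : {A : Set} {B C : A → Set} → (∀ x → B x ⟺ C x) → Σ A B ⟺ Σ A C
Σ-cong-⟺ B⟺C = mk⇔ (λ (x , b) → x , to (B⟺C x) b) (λ (x , c) → x , from (B⟺C x) c)

module Semantics {S : Signature} (M : Model S) where
  open Model M

  _[_↦_] : (Var → Dom) → Var → Dom → Var → Dom
  _[_↦_] = _[_≔_] M

  Agree : (Dom → Dom → Set) → (Var → Set) → (Var → Dom) → (Var → Dom) → Set
  Agree _~_ P g h = ∀ {y} → P y → g y ~ h y

  ↦-same : ∀ {g x a} → (g [ x ↦ a ]) x ≡ a
  ↦-same {x = x} with x ≡ᵇ x | ≡ᵇ-reflects x x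
  ... | true  | _       = refl
  ... | false | ofⁿ x≢x = ⊥-elim (x≢x refl)

  ↦-other : ∀ {g x y a} → y ≢ x → (g [ x ↦ a ]) y ≡ g y
  ↦-other {x = x} {y} y≢x with y ≡ᵇ x | ≡ᵇ-reflects y x
  ... | true  | ofʸ y≡x = ⊥-elim (y≢x y≡x)
  ... | false | _       = refl

  ↦-pointwise : ∀ (_~_ : Dom → Dom → Set) {P : Var → Set} {g h x a} → a ~ a →
                Agree _~_ (λ z → z ≢ x × P z) g h → Agree _~_ P (g [ x ↦ a ]) (h [ x ↦ a ])
  ↦-pointwise _~_ {x = x} a~a g~h {z} Pz with z ≡ᵇ x | ≡ᵇ-reflects z x
  ... | true  | _        = a~a
  ... | false | ofⁿ z≢x = g~h (z≢x , Pz)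

  ↦-comm : ∀ {g x y a b} → x ≢ y → ∀ z → (g [ y ↦ b ] [ x ↦ a ]) z ≡ (g [ x ↦ a ] [ y ↦ b ]) z
  ↦-comm {x = x} {y} x≢y z with z ≡ᵇ x | ≡ᵇ-reflects z x | z ≡ᵇ y | ≡ᵇ-reflects z y
  ... | true  | ofʸ refl | true  | ofʸ refl = ⊥-elim (x≢y refl)
  ... | true  | _        | false | _        = refl
  ... | false | _        | true  | _        = refl
  ... | false | _        | false | _        = refl

  evalT-resp : ∀ (_~_ : Dom → Dom → Set) → (∀ c → I c ~ I c) →
               ∀ t {g h} → Agree _~_ (λ y → FreeT S y t) g h → evalT M g t ~ evalT M h t
  evalT-resp _~_ ~-I (var x) g~h = g~h refl
  evalT-resp _~_ ~-I (con c) g~h = ~-I c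

  evalTs-resp : ∀ (_~_ : Dom → Dom → Set) → (∀ c → I c ~ I c) →
                ∀ {n} (ts : Vec (Term S) n) {g h} → Agree _~_ (λ y → Any (FreeT S y) ts) g h →
                Pointwise _~_ (map (evalT M g) ts) (map (evalT M h) ts)
  evalTs-resp _~_ ~-I []       g~h = []
  evalTs-resp _~_ ~-I (t ∷ ts) g~h =
    evalT-resp _~_ ~-I t (g~h ∘ here) ∷ evalTs-resp _~_ ~-I ts (g~h ∘ there)

  evalT-subst : ∀ x c g t → evalT M g (substT S x (con c) t) ≡ evalT M (g [ x ↦ I c ]) t
  evalT-subst x c g (con d) = refl
  evalT-subst x c g (var y) with x ≡ᵇ y | ≡ᵇ-reflects x y | y ≡ᵇ x | ≡ᵇ-reflects y x
  ... | true  | _        | true  | _        = refl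
  ... | false | _        | false | _        = refl
  ... | true  | ofʸ refl | false | ofⁿ y≢x = ⊥-elim (y≢x refl)
  ... | false | ofⁿ x≢y | true  | ofʸ refl = ⊥-elim (x≢y refl)

  evalTs-subst : ∀ x c g {n} (ts : Vec (Term S) n) →
                 map (evalT M g) (map (substT S x (con c)) ts) ≡ map (evalT M (g [ x ↦ I c ])) ts
  evalTs-subst x c g ts = trans (sym (map-∘ _ _ ts)) (map-cong (evalT-subst x c g) ts)

  Sat-≼ : ∀ φ {w w' g} → w ≼ w' → Sat M w g φ → Sat M w' g φ
  Sat-≼ (atom P ts) w≼w' = Int-≼ w≼w'
  Sat-≼ (t ≐ u)     w≼w' = Sim-≼ w≼w'
  Sat-≼ (φ ∧ ψ)     w≼w' (sφ , sψ) = Sat-≼ φ w≼w' sφ , Sat-≼ ψ w≼w' sψ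
  Sat-≼ (φ ∨ ψ)     w≼w' (inj₁ sφ) = inj₁ (Sat-≼ φ w≼w' sφ)
  Sat-≼ (φ ∨ ψ)     w≼w' (inj₂ sψ) = inj₂ (Sat-≼ ψ w≼w' sψ)
  Sat-≼ (φ ⇒ ψ)     w≼w' s w'' w'≼w'' = s w'' (≼-trans w≼w' w'≼w'')
  Sat-≼ (□ φ)       w≼w' s w'' v w'≼w'' = s w'' v (≼-trans w≼w' w'≼w'')
  Sat-≼ (◇ φ)       w≼w' (v , wRv , sφ) with FC2 w≼w' wRv
  ... | v' , v≼v' , w'Rv' = v' , w'Rv' , Sat-≼ φ v≼v' sφ
  Sat-≼ (all x φ)   w≼w' s w'' w'≼w'' = s w'' (≼-trans w≼w' w'≼w'')
  Sat-≼ (ex x φ)    w≼w' (a , a∈D , sφ) = a , D-≼ w≼w' a∈D , Sat-≼ φ w≼w' sφ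
  Sat-≼ ⊥'          w≼w' ()

  ⇒-elim : ∀ {φ ψ w g} → Sat M w g (φ ⇒ ψ) → Sat M w g φ → Sat M w g ψ
  ⇒-elim {w = w} sφ⇒ψ = sφ⇒ψ w (≼-refl w)

  sat-free : ∀ φ {w g h} → Agree _≡_ (λ y → Free S y φ) g h → Sat M w g φ ⟺ Sat M w h φ
  sat-free (atom P ts) g≡h =
    ≡⇒⟺ (cong (Int _ P) (Pointwise-≡⇒≡ (evalTs-resp _≡_ (λ _ → refl) ts g≡h)))
  sat-free (t ≐ u)     g≡h = ≡⇒⟺ (cong₂ (Sim _) (evalT-resp _≡_ (λ _ → refl) t (g≡h ∘ inj₁))
                                                (evalT-resp _≡_ (λ _ → refl) u (g≡h ∘ inj₂)))
  sat-free (φ ∧ ψ)     g≡h = sat-free φ (g≡h ∘ inj₁) ×-⇔ sat-free ψ (g≡h ∘ inj₂)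
  sat-free (φ ∨ ψ)     g≡h = sat-free φ (g≡h ∘ inj₁) ⊎-⇔ sat-free ψ (g≡h ∘ inj₂)
  sat-free (φ ⇒ ψ)     g≡h =
    Π₂-cong-⟺ λ _ _ → →-cong-⇔ (sat-free φ (g≡h ∘ inj₁)) (sat-free ψ (g≡h ∘ inj₂))
  sat-free (□ φ)       g≡h = Π₂-cong-⟺ λ _ _ → Π₂-cong-⟺ λ _ _ → sat-free φ g≡h
  sat-free (◇ φ)       g≡h = Σ-cong-⟺ λ _ → ⇔-id _ ×-⇔ sat-free φ g≡h
  sat-free (all x φ)   g≡h =
    Π₂-cong-⟺ λ _ _ → Π₂-cong-⟺ λ _ _ → sat-free φ (↦-pointwise _≡_ refl g≡h)
  sat-free (ex x φ)    g≡h = Σ-cong-⟺ λ _ → ⇔-id _ ×-⇔ sat-free φ (↦-pointwise _≡_ refl g≡h)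
  sat-free ⊥'          g≡h = ⇔-id _

  sat-sentence : ∀ φ {w g h} → Sentence S φ → Sat M w g φ → Sat M w h φ
  sat-sentence φ closed = to (sat-free φ λ {y} y∈φ → ⊥-elim (closed y y∈φ))

  sat-subst : ∀ x c φ {w g} → Sat M w g (subst S x (con c) φ) ⟺ Sat M w (g [ x ↦ I c ]) φ
  sat-subst x c (atom P ts) {g = g} = ≡⇒⟺ (cong (Int _ P) (evalTs-subst x c g ts))
  sat-subst x c (t ≐ u)     {g = g} =
    ≡⇒⟺ (cong₂ (Sim _) (evalT-subst x c g t) (evalT-subst x c g u))
  sat-subst x c (φ ∧ ψ)  = sat-subst x c φ ×-⇔ sat-subst x c ψ
  sat-subst x c (φ ∨ ψ)  = sat-subst x c φ ⊎-⇔ sat-subst x c ψ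
  sat-subst x c (φ ⇒ ψ)  = Π₂-cong-⟺ λ _ _ → →-cong-⇔ (sat-subst x c φ) (sat-subst x c ψ)
  sat-subst x c (□ φ)    = Π₂-cong-⟺ λ _ _ → Π₂-cong-⟺ λ _ _ → sat-subst x c φ
  sat-subst x c (◇ φ)    = Σ-cong-⟺ λ _ → ⇔-id _ ×-⇔ sat-subst x c φ
  sat-subst x c (all y φ) {g = g} with x ≡ᵇ y | ≡ᵇ-reflects x y
  ... | true  | ofʸ refl = sat-free (all x φ) λ (z≢x , _) → sym (↦-other {g = g} z≢x)
  ... | false | ofⁿ x≢y =
    Π₂-cong-⟺ λ _ _ → Π₂-cong-⟺ λ _ _ →
      ⟺-trans (sat-subst x c φ) (sat-free φ λ {z} _ → ↦-comm {g = g} x≢y z)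
  sat-subst x c (ex y φ) {g = g} with x ≡ᵇ y | ≡ᵇ-reflects x y
  ... | true  | ofʸ refl = sat-free (ex x φ) λ (z≢x , _) → sym (↦-other {g = g} z≢x)
  ... | false | ofⁿ x≢y =
    Σ-cong-⟺ λ _ → ⇔-id _ ×-⇔
      ⟺-trans (sat-subst x c φ) (sat-free φ λ {z} _ → ↦-comm {g = g} x≢y z)
  sat-subst x c ⊥' = ⇔-id _

  Sim-cong : ∀ {w a a' b b'} → Sim w a a' → Sim w b b' → Sim w a b ⟺ Sim w a' b'
  Sim-cong a∼a' b∼b' = mk⇔ (λ a∼b → Sim-trans (Sim-sym a∼a') (Sim-trans a∼b b∼b'))
                           (λ a'∼b' → Sim-trans a∼a' (Sim-trans a'∼b' (Sim-sym b∼b')))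

  sat-sim : ∀ φ → ModalFree S φ → ∀ {w g h} → Agree (Sim w) (λ y → Free S y φ) g h →
            Sat M w g φ ⟺ Sat M w h φ
  sat-sim (atom P ts) _ {w} g∼h = mk⇔ (Int-Sim gs∼hs) (Int-Sim (Pointwise.sym Sim-sym gs∼hs))
    where gs∼hs = evalTs-resp (Sim w) (λ c → Sim-refl (I-dom c w)) ts g∼h
  sat-sim (t ≐ u) _ {w} g∼h = Sim-cong (evalT-resp (Sim w) I∼I t (g∼h ∘ inj₁))
                                       (evalT-resp (Sim w) I∼I u (g∼h ∘ inj₂))
    where I∼I = λ c → Sim-refl (I-dom c w)
  sat-sim (φ ∧ ψ) (mφ , mψ) g∼h = sat-sim φ mφ (g∼h ∘ inj₁) ×-⇔ sat-sim ψ mψ (g∼h ∘ inj₂)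
  sat-sim (φ ∨ ψ) (mφ , mψ) g∼h = sat-sim φ mφ (g∼h ∘ inj₁) ⊎-⇔ sat-sim ψ mψ (g∼h ∘ inj₂)
  sat-sim (φ ⇒ ψ) (mφ , mψ) g∼h = Π₂-cong-⟺ λ _ w≼w' →
    →-cong-⇔ (sat-sim φ mφ (Sim-≼ w≼w' ∘ g∼h ∘ inj₁)) (sat-sim ψ mψ (Sim-≼ w≼w' ∘ g∼h ∘ inj₂))
  sat-sim (all x φ) mφ g∼h = Π₂-cong-⟺ λ w' w≼w' → Π₂-cong-⟺ λ _ a∈D →
    sat-sim φ mφ (↦-pointwise (Sim w') (Sim-refl a∈D) (Sim-≼ w≼w' ∘ g∼h))
  sat-sim (ex x φ) mφ {w} g∼h = Σ-cong-⟺ λ _ → Σ-cong-⟺ λ a∈D →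
    sat-sim φ mφ (↦-pointwise (Sim w) (Sim-refl a∈D) g∼h)
  sat-sim (□ φ) ()
  sat-sim (◇ φ) ()
  sat-sim ⊥' _ _ = ⇔-id _

  ipc-valid : ∀ {A} → IPC A → ∀ σ w g → Sat M w g (inst S σ A)
  ipc-valid (ax-K A B)     σ w g _ _ sA w' w≼w' _ = Sat-≼ (inst S σ A) w≼w' sA
  ipc-valid (ax-S A B C)   σ w g _ _ sABC w' w≼w' sAB w'' w'≼w'' sA =
    ⇒-elim {inst S σ B} {inst S σ C} (sABC w'' (≼-trans w≼w' w'≼w'') sA) (sAB w'' w'≼w'' sA)
  ipc-valid (ax-∧I A B)    σ w g _ _ sA w' w≼w' sB = Sat-≼ (inst S σ A) w≼w' sA , sB
  ipc-valid (ax-∧E₁ A B)   σ w g _ _ = proj₁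
  ipc-valid (ax-∧E₂ A B)   σ w g _ _ = proj₂
  ipc-valid (ax-∨I₁ A B)   σ w g _ _ = inj₁
  ipc-valid (ax-∨I₂ A B)   σ w g _ _ = inj₂
  ipc-valid (ax-∨E A B C)  σ w g _ _ sAC w' w≼w' sBC w'' w'≼w'' (inj₁ sA) =
    sAC w'' (≼-trans w≼w' w'≼w'') sA
  ipc-valid (ax-∨E A B C)  σ w g _ _ sAC w' w≼w' sBC w'' w'≼w'' (inj₂ sB) = sBC w'' w'≼w'' sB
  ipc-valid (ax-EFQ A)     σ w g _ _ ()
  ipc-valid (mp {A} {B} ⊢A⇒B ⊢A) σ w g =
    ⇒-elim {inst S σ A} {inst S σ B} (ipc-valid ⊢A⇒B σ w g) (ipc-valid ⊢A σ w g)

module Reinterpretation {S : Signature} (M : Model S) (c : Const) (a : Model.Dom M) where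
  open Model M

  D⁺ : W → Dom → Set
  D⁺ w b = D w b ⊎ b ≡ a

  Sim⁺ : W → Dom → Dom → Set
  Sim⁺ w b b' = Sim w b b' ⊎ (b ≡ a × b' ≡ a)

  Sim⁺-trans : ∀ {w b b' b''} → Sim⁺ w b b' → Sim⁺ w b' b'' → Sim⁺ w b b''
  Sim⁺-trans (inj₁ b∼b')           (inj₁ b'∼b'')        = inj₁ (Sim-trans b∼b' b'∼b'')
  Sim⁺-trans (inj₁ b∼a)            (inj₂ (refl , refl)) = inj₁ b∼a
  Sim⁺-trans (inj₂ (refl , refl)) a∼b''                = a∼b''

  frame⁺ : Frame
  frame⁺ = record
    { W = W ; _≼_ = _≼_ ; ≼-refl = ≼-refl ; ≼-trans = ≼-trans ; ≼-antisym = ≼-antisym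
    ; R = R ; FC1 = FC1 ; FC2 = FC2
    ; Dom = Dom ; D = D⁺
    ; D-≼ = λ w≼w' → map₁ (D-≼ w≼w')
    ; D-R = λ wRw' → map₁ (D-R wRw')
    ; Sim = Sim⁺
    ; Sim-dom = λ { (inj₁ b∼b') → inj₁ (proj₁ (Sim-dom b∼b')) , inj₁ (proj₂ (Sim-dom b∼b'))
                  ; (inj₂ (b≡a , b'≡a)) → inj₂ b≡a , inj₂ b'≡a }
    ; Sim-refl = λ { (inj₁ b∈D) → inj₁ (Sim-refl b∈D) ; (inj₂ b≡a) → inj₂ (b≡a , b≡a) }
    ; Sim-sym = λ { (inj₁ b∼b') → inj₁ (Sim-sym b∼b') ; (inj₂ (b≡a , b'≡a)) → inj₂ (b'≡a , b≡a) }
    ; Sim-trans = Sim⁺-trans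
    ; Sim-≼ = λ w≼w' → map₁ (Sim-≼ w≼w')
    }

  I⁺ : Const → Dom
  I⁺ d = if d ≡ᵇ c then a else I d

  I⁺-c : I⁺ c ≡ a
  I⁺-c with c ≡ᵇ c | ≡ᵇ-reflects c c
  ... | true  | _       = refl
  ... | false | ofⁿ c≢c = ⊥-elim (c≢c refl)

  I⁺-other : ∀ {d} → d ≢ c → I⁺ d ≡ I d
  I⁺-other {d} d≢c with d ≡ᵇ c | ≡ᵇ-reflects d c
  ... | true  | ofʸ d≡c = ⊥-elim (d≢c d≡c)
  ... | false | _       = refl

  I⁺-dom : ∀ d w → D⁺ w (I⁺ d)
  I⁺-dom d w with d ≡ᵇ c
  ... | true  = inj₂ refl
  ... | false = inj₁ (I-dom d w)

  Sims⁺⇒Sims : ∀ {w n} {bs bs' : Vec Dom n} →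
               All (D w) bs → Pointwise (Sim⁺ w) bs bs' → Pointwise (Sim w) bs bs'
  Sims⁺⇒Sims []           []                             = []
  Sims⁺⇒Sims (_   ∷ bs∈D) (inj₁ b∼b' ∷ bs∼bs')          = b∼b' ∷ Sims⁺⇒Sims bs∈D bs∼bs'
  Sims⁺⇒Sims (b∈D ∷ bs∈D) (inj₂ (refl , refl) ∷ bs∼bs') = Sim-refl b∈D ∷ Sims⁺⇒Sims bs∈D bs∼bs'

  model : Model S
  model = record
    { frame = frame⁺ ; I = I⁺ ; I-dom = I⁺-dom
    ; Int = Int ; Int-dom = All.map inj₁ ∘ Int-dom ; Int-≼ = Int-≼
    ; Int-Sim = λ bs∼bs' i → Int-Sim (Sims⁺⇒Sims (Int-dom i) bs∼bs') i
    }

  D⁺⟺D : ∀ {w b} → D w a → D⁺ w b ⟺ D w b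
  D⁺⟺D a∈D = mk⇔ (λ { (inj₁ b∈D) → b∈D ; (inj₂ refl) → a∈D }) inj₁

  Sim⁺⟺Sim : ∀ {w b b'} → D w a → Sim⁺ w b b' ⟺ Sim w b b'
  Sim⁺⟺Sim a∈D = mk⇔ (λ { (inj₁ b∼b') → b∼b' ; (inj₂ (refl , refl)) → Sim-refl a∈D }) inj₁

  evalT⁺ : ∀ g t → ¬ ConstT S c t → evalT model g t ≡ evalT M g t
  evalT⁺ g (var x) _   = refl
  evalT⁺ g (con d) c∉t = I⁺-other (c∉t ∘ sym)

  evalTs⁺ : ∀ g {n} (ts : Vec (Term S) n) → ¬ Any (ConstT S c) ts →
            map (evalT model g) ts ≡ map (evalT M g) ts
  evalTs⁺ g []       _    = refl
  evalTs⁺ g (t ∷ ts) c∉ts = cong₂ _∷_ (evalT⁺ g t (c∉ts ∘ here)) (evalTs⁺ g ts (c∉ts ∘ there))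

  sat⁺⟺sat : ∀ φ → ¬ ConstIn S c φ → ∀ {w g} → D w a → Sat model w g φ ⟺ Sat M w g φ
  sat⁺⟺sat (atom P ts) c∉φ {w} {g} _ = ≡⇒⟺ (cong (Int w P) (evalTs⁺ g ts c∉φ))
  sat⁺⟺sat (t ≐ u)     c∉φ {w} {g} a∈D = ⟺-trans (Sim⁺⟺Sim a∈D)
    (≡⇒⟺ (cong₂ (Sim w) (evalT⁺ g t (c∉φ ∘ inj₁)) (evalT⁺ g u (c∉φ ∘ inj₂))))
  sat⁺⟺sat (φ ∧ ψ) c∉φ a∈D = sat⁺⟺sat φ (c∉φ ∘ inj₁) a∈D ×-⇔ sat⁺⟺sat ψ (c∉φ ∘ inj₂) a∈D
  sat⁺⟺sat (φ ∨ ψ) c∉φ a∈D = sat⁺⟺sat φ (c∉φ ∘ inj₁) a∈D ⊎-⇔ sat⁺⟺sat ψ (c∉φ ∘ inj₂) a∈D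
  sat⁺⟺sat (φ ⇒ ψ) c∉φ a∈D = Π₂-cong-⟺ λ _ w≼w' →
    →-cong-⇔ (sat⁺⟺sat φ (c∉φ ∘ inj₁) (D-≼ w≼w' a∈D)) (sat⁺⟺sat ψ (c∉φ ∘ inj₂) (D-≼ w≼w' a∈D))
  sat⁺⟺sat (□ φ)   c∉φ a∈D = Π₂-cong-⟺ λ _ _ → Π₂-cong-⟺ λ w≼w' w'Rv →
    sat⁺⟺sat φ c∉φ (D-R w'Rv (D-≼ w≼w' a∈D))
  sat⁺⟺sat (◇ φ)   c∉φ a∈D = Σ-cong-⟺ λ _ → Σ-cong-⟺ λ wRv → sat⁺⟺sat φ c∉φ (D-R wRv a∈D)
  sat⁺⟺sat (all x φ) c∉φ a∈D = Π₂-cong-⟺ λ _ w≼w' → Π-cong-⟺ λ _ →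
    →-cong-⇔ (D⁺⟺D (D-≼ w≼w' a∈D)) (sat⁺⟺sat φ c∉φ (D-≼ w≼w' a∈D))
  sat⁺⟺sat (ex x φ) c∉φ a∈D = Σ-cong-⟺ λ _ → D⁺⟺D a∈D ×-⇔ sat⁺⟺sat φ c∉φ a∈D
  sat⁺⟺sat ⊥' _ _ = ⇔-id _

  sat-at-fresh-constant : ∀ x φ → ¬ ConstIn S c φ → ∀ {w g} → D w a →
                          Sat model w g (subst S x (con c) φ) → Sat M w (_[_≔_] M g x a) φ
  sat-at-fresh-constant x φ c∉φ {w} {g} a∈D =
    to (sat⁺⟺sat φ c∉φ a∈D)
    ∘ ≡-subst (λ b → Sat model w (g [ x ↦ b ]) φ) I⁺-c
    ∘ to (sat-subst x c φ)
    where open Semantics model using (_[_↦_]; sat-subst)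

module FOFSAxioms {S : Signature} (M : Model S) where
  open Model M
  open Semantics M

  □-∧-valid : ∀ φ ψ w g → Sat M w g (_⇔_ S (□ (φ ∧ ψ)) (□ φ ∧ □ ψ))
  □-∧-valid φ ψ w g =
    (λ _ _ □φ∧ψ → (λ w' v w≼w' w'Rv → proj₁ (□φ∧ψ w' v w≼w' w'Rv))
                 , (λ w' v w≼w' w'Rv → proj₂ (□φ∧ψ w' v w≼w' w'Rv))) ,
    (λ _ _ (□φ , □ψ) w' v w≼w' w'Rv → □φ w' v w≼w' w'Rv , □ψ w' v w≼w' w'Rv)

  □⊤-valid : ∀ w g → Sat M w g (□ (⊤' S))
  □⊤-valid w g _ _ _ _ _ _ ()

  ◇-∨-valid : ∀ φ ψ w g → Sat M w g (_⇔_ S (◇ (φ ∨ ψ)) (◇ φ ∨ ◇ ψ))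
  ◇-∨-valid φ ψ w g =
    (λ { _ _ (v , wRv , inj₁ sφ) → inj₁ (v , wRv , sφ)
       ; _ _ (v , wRv , inj₂ sψ) → inj₂ (v , wRv , sψ) }) ,
    (λ { _ _ (inj₁ (v , wRv , sφ)) → v , wRv , inj₁ sφ
       ; _ _ (inj₂ (v , wRv , sψ)) → v , wRv , inj₂ sψ })

  ¬◇⊥-valid : ∀ w g → Sat M w g (¬' S (◇ ⊥'))
  ¬◇⊥-valid w g _ _ (_ , _ , ())

  ◇⇒□-valid : ∀ φ ψ w g → Sat M w g ((◇ φ ⇒ □ ψ) ⇒ □ (φ ⇒ ψ))
  ◇⇒□-valid φ ψ w g w₁ _ ◇φ⇒□ψ w₂ v w₁≼w₂ w₂Rv v' v≼v' sφ with FC1 w₂Rv v≼v'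
  ... | w₃ , w₂≼w₃ , w₃Rv' =
    ◇φ⇒□ψ w₃ (≼-trans w₁≼w₂ w₂≼w₃) (v' , w₃Rv' , sφ) w₃ v' (≼-refl w₃) w₃Rv'

  ◇⇒-valid : ∀ φ ψ w g → Sat M w g (◇ (φ ⇒ ψ) ⇒ (□ φ ⇒ ◇ ψ))
  ◇⇒-valid φ ψ w g w₁ _ (v , w₁Rv , sφ⇒ψ) w₂ w₁≼w₂ □φ with FC2 w₁≼w₂ w₁Rv
  ... | v' , v≼v' , w₂Rv' = v' , w₂Rv' , sφ⇒ψ v' v≼v' (□φ w₂ v' (≼-refl w₂) w₂Rv')

  ∀-inst-valid : ∀ x φ c w g → Sat M w g (all x φ ⇒ subst S x (con c) φ)
  ∀-inst-valid x φ c w g w₁ _ ∀φ = from (sat-subst x c φ) (∀φ w₁ (≼-refl w₁) (I c) (I-dom c w₁))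

  ∃-intro-valid : ∀ x φ c w g → Sat M w g (subst S x (con c) φ ⇒ ex x φ)
  ∃-intro-valid x φ c w g w₁ _ sφc = I c , I-dom c w₁ , to (sat-subst x c φ) sφc

  ∃-elim-valid : ∀ x φ ψ → Sentence S ψ → ∀ w g → Sat M w g (all x (φ ⇒ ψ) ⇒ (ex x φ ⇒ ψ))
  ∃-elim-valid x φ ψ ψ-closed w g w₁ _ ∀φ⇒ψ w₂ w₁≼w₂ (a , a∈D , sφ) =
    sat-sentence ψ ψ-closed (⇒-elim {φ} {ψ} (∀φ⇒ψ w₂ w₁≼w₂ a a∈D) sφ)

  ∀-dist-valid : ∀ x φ ψ → Sentence S φ → ∀ w g → Sat M w g (all x (φ ⇒ ψ) ⇒ (φ ⇒ all x ψ))
  ∀-dist-valid x φ ψ φ-closed w g w₁ _ ∀φ⇒ψ w₂ w₁≼w₂ sφ w₃ w₂≼w₃ a a∈D =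
    ⇒-elim {φ} {ψ} (∀φ⇒ψ w₃ (≼-trans w₁≼w₂ w₂≼w₃) a a∈D)
                   (sat-sentence φ φ-closed (Sat-≼ φ w₂≼w₃ sφ))

  refl≐-valid : ∀ c w g → Sat M w g (con c ≐ con c)
  refl≐-valid c w g = Sim-refl (I-dom c w)

  repl≐-valid : ∀ x φ c₁ c₂ → OnePlace S x φ → ModalFree S φ → ∀ w g →
                Sat M w g ((con c₁ ≐ con c₂) ⇒ (subst S x (con c₁) φ ⇒ subst S x (con c₂) φ))
  repl≐-valid x φ c₁ c₂ one-place modal-free w g w₁ _ c₁∼c₂ w₂ w₁≼w₂ =
    from (sat-subst x c₂ φ) ∘ to (sat-sim φ modal-free c₁∼c₂-at-x) ∘ to (sat-subst x c₁ φ)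
    where
    c₁∼c₂-at-x : Agree (Sim w₂) (λ y → Free S y φ) (g [ x ↦ I c₁ ]) (g [ x ↦ I c₂ ])
    c₁∼c₂-at-x y∈φ with one-place _ y∈φ
    ... | refl = ≡-subst₂ (Sim w₂) (sym (↦-same {g})) (sym (↦-same {g})) (Sim-≼ w₁≼w₂ c₁∼c₂)

  □-mono-valid : ∀ φ ψ {g} → (∀ v → Sat M v g (φ ⇒ ψ)) → ∀ w → Sat M w g (□ φ ⇒ □ ψ)
  □-mono-valid φ ψ φ⇒ψ w _ _ □φ w' v w≼w' w'Rv = ⇒-elim {φ} {ψ} (φ⇒ψ v) (□φ w' v w≼w' w'Rv)

  ◇-mono-valid : ∀ φ ψ {g} → (∀ v → Sat M v g (φ ⇒ ψ)) → ∀ w → Sat M w g (◇ φ ⇒ ◇ ψ)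
  ◇-mono-valid φ ψ φ⇒ψ w _ _ (v , wRv , sφ) = v , wRv , ⇒-elim {φ} {ψ} (φ⇒ψ v) sφ

ValidIn : (S : Signature) → (Frame → Set) → Form S → Set₁
ValidIn S C φ = ∀ (M : Model S) → C (Model.frame M) → ∀ w g → Sat M w g φ

ReinterpretationClosed : Signature → (Frame → Set) → Set₁
ReinterpretationClosed S C =
  ∀ (M : Model S) c a → C (Model.frame M) → C (Model.frame (Reinterpretation.model M c a))

module _ {S : Signature} {L : Logic} {C : Frame → Set}
         (C-closed : ReinterpretationClosed S C)
         (extra-valid : ∀ {φ} → ExtraAx S L φ → ValidIn S C φ) where
  open FOFSAxioms

  prf-valid : ∀ {φ} → Prf S L φ → ValidIn S C φ
  prf-valid (taut σ _ A ⊢A)            M _ = Semantics.ipc-valid M ⊢A σ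
  prf-valid (□∧ φ ψ _ _)               M _ = □-∧-valid M φ ψ
  prf-valid □⊤                         M _ = □⊤-valid M
  prf-valid (◇∨ φ ψ _ _)               M _ = ◇-∨-valid M φ ψ
  prf-valid ¬◇⊥                        M _ = ¬◇⊥-valid M
  prf-valid (ax-◇□ φ ψ _ _)            M _ = ◇⇒□-valid M φ ψ
  prf-valid (ax-◇⇒ φ ψ _ _)            M _ = ◇⇒-valid M φ ψ
  prf-valid (∀-inst x φ c _)           M _ = ∀-inst-valid M x φ c
  prf-valid (∃-intro x φ c _)          M _ = ∃-intro-valid M x φ c
  prf-valid (∃-elim x φ ψ _ ψ-closed)  M _ = ∃-elim-valid M x φ ψ ψ-closed
  prf-valid (∀-dist x φ ψ φ-closed _)  M _ = ∀-dist-valid M x φ ψ φ-closed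
  prf-valid (refl≐ c)                  M _ = refl≐-valid M c
  prf-valid (repl≐ x φ c₁ c₂ one-place mf) M _ = repl≐-valid M x φ c₁ c₂ one-place mf
  prf-valid (extra φ _ ax)             = extra-valid ax
  prf-valid (mp {φ} {ψ} ⊢φ⇒ψ ⊢φ)       M M∈C w g =
    Semantics.⇒-elim M {φ} {ψ} (prf-valid ⊢φ⇒ψ M M∈C w g) (prf-valid ⊢φ M M∈C w g)
  prf-valid (gen x φ c _ c∉φ ⊢φc)      M M∈C w g w' _ a a∈D =
    sat-at-fresh-constant x φ c∉φ a∈D (prf-valid ⊢φc model (C-closed M c a M∈C) w' g)
    where open Reinterpretation M c a
  prf-valid (mono□ {φ} {ψ} _ _ ⊢φ⇒ψ)   M M∈C w g =
    □-mono-valid M φ ψ (λ v → prf-valid ⊢φ⇒ψ M M∈C v g) w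
  prf-valid (mono◇ {φ} {ψ} _ _ ⊢φ⇒ψ)   M M∈C w g =
    ◇-mono-valid M φ ψ (λ v → prf-valid ⊢φ⇒ψ M M∈C v g) w

  -- The hypothesis that g takes values in D w is not needed.
  soundness : SoundFor S L C
  soundness φ ⊢φ M M∈C w g _ = prf-valid ⊢φ M M∈C w g

module _ {S : Signature} where

  D-valid : ∀ φ → ValidIn S Serial (□ φ ⇒ ◇ φ)
  D-valid φ M serial w g w₁ _ □φ with serial w₁
  ... | v , w₁Rv = v , w₁Rv , □φ w₁ v (Model.≼-refl M w₁) w₁Rv

  4□-valid : ∀ φ → ValidIn S Transitive (□ φ ⇒ □ (□ φ))
  4□-valid φ M transitive w g w₁ _ □φ w₂ v w₁≼w₂ w₂Rv w₃ u v≼w₃ w₃Ru with Model.FC1 M w₂Rv v≼w₃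
  ... | w₄ , w₂≼w₄ , w₄Rw₃ = □φ w₄ u (Model.≼-trans M w₁≼w₂ w₂≼w₄) (transitive w₄Rw₃ w₃Ru)

  4◇-valid : ∀ φ → ValidIn S Transitive (◇ (◇ φ) ⇒ ◇ φ)
  4◇-valid φ M transitive w g w₁ _ (v , w₁Rv , u , vRu , sφ) = u , transitive w₁Rv vRu , sφ

  T□-valid : ∀ φ → ValidIn S Reflexive (□ φ ⇒ φ)
  T□-valid φ M reflexive w g w₁ _ □φ = □φ w₁ w₁ (Model.≼-refl M w₁) (reflexive w₁)

  T◇-valid : ∀ φ → ValidIn S Reflexive (φ ⇒ ◇ φ)
  T◇-valid φ M reflexive w g w₁ _ sφ = w₁ , reflexive w₁ , sφ

-- Reinterpreting a constant changes only domains and ∼, so every condition on R is preserved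
-- definitionally.
mainTheorem3 : (S : Signature) →
    SoundFor S FOFS-D Serial ×
    SoundFor S FOFS4 Transitive ×
    SoundFor S FOFS-D4 (λ F → Serial F × Transitive F) ×
    SoundFor S FOFS-T Reflexive ×
    SoundFor S FOFS-S4 (λ F → Reflexive F × Transitive F)
mainTheorem3 S =
  soundness (λ _ _ _ → id) (λ { (D-D φ) → D-valid φ }) ,
  soundness (λ _ _ _ → id) (λ { (4-□ φ) → 4□-valid φ ; (4-◇ φ) → 4◇-valid φ }) ,
  soundness (λ _ _ _ → id)
    (λ { (D4-D φ) M (p , _) → D-valid φ M p
       ; (D4-□ φ) M (_ , p) → 4□-valid φ M p
       ; (D4-◇ φ) M (_ , p) → 4◇-valid φ M p }) ,
  soundness (λ _ _ _ → id) (λ { (T-□ φ) → T□-valid φ ; (T-◇ φ) → T◇-valid φ }) ,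
  soundness (λ _ _ _ → id)
    (λ { (S4-T□ φ) M (p , _) → T□-valid φ M p
       ; (S4-T◇ φ) M (p , _) → T◇-valid φ M p
       ; (S4-4□ φ) M (_ , p) → 4□-valid φ M p
       ; (S4-4◇ φ) M (_ , p) → 4◇-valid φ M p })
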